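{- Let $t\ge1$, let $k_1,\ldots,k_t\ge 2$ be integers, $k_i':=k_i-1$ and $\kappa:=\sum_{i=1}^t k_i'$. Let $H=(V,E)$ be a graph whose vertex set is partitioned into two sets $U$ and $W$ such that every edge of $H$ has at least one endpoint in $U$ (i.e. $E=E(H[U])\cup E(H[U,W])$). If $H$ contains a path on $4\kappa+t$ vertices, then $H$ contains $t$ pairwise vertex-disjoint paths on $2k_1'+1,\ldots,2k_t'+1$ vertices respectively, all of whose endpoints lie in $U$.
   Context: $H[U]$ is the subgraph induced by $U$; $H[U,W]$ is the bipartite subgraph consisting of all edges of $H$ with one endpoint in $U$ and the other in $W$. -}

module Defs where

open import Data.Nat using (ℕ; zero; suc; _+_; _*_; _∸_)
open import Data.Fin using (Fin; zero; suc; toℕ; inject₁; fromℕ)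
open import Data.Bool using (Bool; true)
open import Data.Product using (_×_)
open import Data.Empty using (⊥)
open import Data.Sum using (_⊎_)
open import Relation.Nullary using (¬_)
open import Relation.Binary.PropositionalEquality using (_≡_)
open import Function.Definitions using (Injective)
open import Data.Vec.Functional using (Vector)
import Data.Vec.Functional as VF

record Graph (n : ℕ) : Set₁ where
  field
    Adj   : Fin n → Fin n → Set
    sym   : ∀ {x y} → Adj x y → Adj y x
    irrefl : ∀ {x} → ¬ Adj x x
open Graph public

Σ[_] : ∀ {t} → (Fin t → ℕ) → ℕ
Σ[_] {zero}  f = 0
Σ[_] {suc t} f = f zero + Σ[_] (λ i → f (suc i))

-- A path on m+1 vertices in G: an injective sequence of vertices
-- v₀,…,v_m with consecutive vertices adjacent.
record Path {n : ℕ} (G : Graph n) (m : ℕ) : Set where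
  field
    vert  : Fin (suc m) → Fin n
    inj   : Injective _≡_ _≡_ vert
    adj   : ∀ (i : Fin m) → Adj G (vert (inject₁ i)) (vert (suc i))
open Path public

start : ∀ {n m} {G : Graph n} → Path G m → Fin n
start P = vert P zero

end : ∀ {n m} {G : Graph n} → Path G m → Fin n
end {m = m} P = vert P (fromℕ m)

Disjoint : ∀ {n m m'} {G : Graph n} → Path G m → Path G m' → Set
Disjoint P Q = ∀ i j → ¬ (vert P i ≡ vert Q j)

-- every edge has at least one endpoint in U  (U given by its indicator; W = complement)
EdgesMeetU : ∀ {n} → Graph n → (Fin n → Bool) → Set
EdgesMeetU G inU = ∀ x y → Adj G x y → (inU x ≡ true) ⊎ (inU y ≡ true)

-- Along a path, no two consecutive vertices lie outside U, since W is independent. Hence among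
-- 4c + 1 consecutive vertices v(0), …, v(4c) there are v(j), v(j + 2c) ∈ U with j ≤ 2c: take
-- j ∈ {0, 1} with v(j) ∈ U. If v(z) ∉ U for z = j + 2c, move j ↦ j + 2 for as long as v(j + 2c)
-- and v(j + 1) both lie outside U (so that v(j + 2) ∈ U); otherwise j or j + 1 is good. Since j
-- keeps the parity of z and stays in U, it never reaches z, so the walk stops. Cutting the long
-- path into t consecutive stretches of 4k′ᵢ + 1 vertices gives the t disjoint subpaths.
module Submission where

open import Defs hiding (sym)
open import Data.Nat using (ℕ; zero; suc; _+_; _*_; _∸_; _≤_; _<_; z≤n; s≤s; >-nonZero)
open import Data.Nat.Properties
open import Data.Nat.Tactic.RingSolver using (solve-∀)
open import Data.Fin as Fin using (Fin; zero; suc; toℕ; inject₁; fromℕ<)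
open import Data.Fin.Properties as Finₚ using (toℕ-inject₁; toℕ-fromℕ; toℕ-fromℕ<; toℕ-injective; toℕ<n)
open import Data.Bool using (Bool; true; false)
open import Data.Product using (Σ; ∃-syntax; _×_; _,_)
open import Data.Sum using (inj₁; inj₂)
open import Function using (_∘_)
open import Relation.Binary.Definitions using (tri<; tri≈; tri>)
open import Relation.Nullary using (¬_; contradiction)
open import Relation.Binary.PropositionalEquality

NoConsecutiveFalse : ℕ → (ℕ → Bool) → Set
NoConsecutiveFalse ℓ g = ∀ i → suc i < ℓ → g i ≡ false → g (suc i) ≡ true

NoConsecutiveFalse-mono : ∀ {g ℓ ℓ′} → ℓ′ ≤ ℓ → NoConsecutiveFalse ℓ g → NoConsecutiveFalse ℓ′ g
NoConsecutiveFalse-mono ℓ′≤ℓ nc i i<ℓ′ = nc i (<-≤-trans i<ℓ′ ℓ′≤ℓ)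

NoConsecutiveFalse-shift : ∀ {g} o ℓ → NoConsecutiveFalse (o + ℓ) g → NoConsecutiveFalse ℓ (g ∘ (o +_))
NoConsecutiveFalse-shift {g} o ℓ nc i i<ℓ gi =
  subst (λ x → g x ≡ true) (sym (+-suc o i))
    (nc (o + i) (subst (_< o + ℓ) (+-suc o i) (+-monoʳ-< o i<ℓ)) gi)

TrueEndedWindow : ℕ → (ℕ → Bool) → Set
TrueEndedWindow d g = ∃[ j ] j ≤ d × g j ≡ true × g (j + d) ≡ true

module _ {g : ℕ → Bool} {d : ℕ} (nc : NoConsecutiveFalse (suc (2 * d)) g) where

  private
    +-≤-double : ∀ {x} → x ≤ d → x + d ≤ 2 * d
    +-≤-double {x} x≤d = subst (x + d ≤_) (cong (d +_) (sym (+-identityʳ d))) (+-monoˡ-≤ d x≤d)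

    two-steps : ∀ j m → suc (suc j) + 2 * m ≡ j + 2 * suc m
    two-steps = solve-∀

  true-ended-window-walk : ∀ m j → j + 2 * m ≤ suc d →
    g j ≡ true → g (j + 2 * m) ≡ false → TrueEndedWindow d g
  true-ended-window-walk zero j _ gj gj′ =
    contradiction (trans (sym gj) (subst (λ x → g x ≡ false) (+-identityʳ j) gj′)) λ ()
  true-ended-window-walk (suc m) j bound gj gj+2m = continue (g (j + d)) refl (g (suc j)) refl
    where
    bound′ : suc (suc j) + 2 * m ≤ suc d
    bound′ = subst (_≤ suc d) (sym (two-steps j m)) bound
    j<d : j < d
    j<d = ≤-pred (≤-trans (m≤m+n _ _) bound′)
    continue : ∀ b → g (j + d) ≡ b → ∀ b′ → g (suc j) ≡ b′ → TrueEndedWindow d g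
    continue true  gj+d _     _   = j , <⇒≤ j<d , gj , gj+d
    continue false gj+d true  gsj = suc j , j<d , gsj , nc (j + d) (s≤s (+-≤-double j<d)) gj+d
    continue false gj+d false gsj =
      true-ended-window-walk m (suc (suc j)) bound′
        (nc (suc j) (s≤s (≤-trans (s≤s (m<m+n j (≤-trans (s≤s z≤n) j<d))) (+-≤-double j<d))) gsj)
        (subst (λ x → g x ≡ false) (sym (two-steps j m)) gj+2m)

true-ended-window : ∀ {g} c → 1 ≤ c → NoConsecutiveFalse (suc (4 * c)) g → TrueEndedWindow (2 * c) g
true-ended-window {g} c c≥1 nc = from first-true
  where
  1≤2c : 1 ≤ 2 * c
  1≤2c = ≤-trans c≥1 (m≤m+n c _)
  first-true : ∃[ j ] j ≤ 1 × g j ≡ true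
  first-true with g 0 in g0
  ... | true  = 0 , z≤n , g0
  ... | false = 1 , ≤-refl , nc 0 (s≤s (≤-trans c≥1 (m≤m+n c _))) g0
  from : ∃[ j ] j ≤ 1 × g j ≡ true → TrueEndedWindow (2 * c) g
  from (j , j≤1 , gj) with g (j + 2 * c) in gj+2c
  ... | true  = j , ≤-trans j≤1 1≤2c , gj , gj+2c
  ... | false = true-ended-window-walk nc′ c j (+-monoˡ-≤ (2 * c) j≤1) gj gj+2c
    where
    nc′ : NoConsecutiveFalse (suc (2 * (2 * c))) g
    nc′ = subst (λ ℓ → NoConsecutiveFalse (suc ℓ) g) (*-assoc 2 2 c) nc

record TrueEndedWindows {t} (ℓ : ℕ) (d : Fin t → ℕ) (g : ℕ → Bool) : Set where
  field
    left       : Fin t → ℕ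
    fits       : ∀ i → left i + d i < ℓ
    left-true  : ∀ i → g (left i) ≡ true
    right-true : ∀ i → g (left i + d i) ≡ true
    ordered    : ∀ {i j} → i Fin.< j → left i + d i < left j

true-ended-windows : ∀ {t} (c : Fin t → ℕ) → (∀ i → 1 ≤ c i) → ∀ {g} →
  NoConsecutiveFalse (4 * Σ[ c ] + t) g → TrueEndedWindows (4 * Σ[ c ] + t) (λ i → 2 * c i) g
true-ended-windows {zero} c _ _ = record
  { left = λ () ; fits = λ () ; left-true = λ () ; right-true = λ () ; ordered = λ { {()} } }
true-ended-windows {suc t} c c≥1 {g} nc =
  subst (λ ℓ → TrueEndedWindows ℓ (λ i → 2 * c i) g) (sym split) (windows head)
  where
  o : ℕ
  o = suc (4 * c zero)
  rest : ℕ
  rest = 4 * Σ[ c ∘ suc ] + t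
  split : 4 * Σ[ c ] + suc t ≡ o + rest
  split = lemma (c zero) (Σ[ c ∘ suc ]) t
    where
    lemma : ∀ a b t → 4 * (a + b) + suc t ≡ suc (4 * a) + (4 * b + t)
    lemma = solve-∀
  nc′ : NoConsecutiveFalse (o + rest) g
  nc′ = subst (λ ℓ → NoConsecutiveFalse ℓ g) split nc
  head : TrueEndedWindow (2 * c zero) g
  head = true-ended-window (c zero) (c≥1 zero) (NoConsecutiveFalse-mono (m≤m+n o rest) nc′)
  module Tail = TrueEndedWindows
    (true-ended-windows (c ∘ suc) (c≥1 ∘ suc) (NoConsecutiveFalse-shift o rest nc′))
  windows : TrueEndedWindow (2 * c zero) g → TrueEndedWindows (o + rest) (λ i → 2 * c i) g
  windows (j , j≤2c , gj , gj+2c) = record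
    { left = left ; fits = fits ; left-true = left-true ; right-true = right-true ; ordered = ordered }
    where
    head-before : ∀ x → j + 2 * c zero < o + x
    head-before x = ≤-trans (s≤s (≤-trans (+-monoˡ-≤ (2 * c zero) j≤2c) (≤-reflexive (double (c zero)))))
                            (m≤m+n o x)
      where
      double : ∀ a → 2 * a + 2 * a ≡ 4 * a
      double = solve-∀
    left : Fin (suc t) → ℕ
    left zero    = j
    left (suc i) = o + Tail.left i
    shifted : ∀ i → o + Tail.left i + 2 * c (suc i) ≡ o + (Tail.left i + 2 * c (suc i))
    shifted i = +-assoc o (Tail.left i) (2 * c (suc i))
    fits : ∀ i → left i + 2 * c i < o + rest
    fits zero    = head-before rest
    fits (suc i) = subst (_< o + rest) (sym (shifted i)) (+-monoʳ-< o (Tail.fits i))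
    left-true : ∀ i → g (left i) ≡ true
    left-true zero    = gj
    left-true (suc i) = Tail.left-true i
    right-true : ∀ i → g (left i + 2 * c i) ≡ true
    right-true zero    = gj+2c
    right-true (suc i) = subst (λ x → g x ≡ true) (sym (shifted i)) (Tail.right-true i)
    ordered : ∀ {i k} → i Fin.< k → left i + 2 * c i < left k
    ordered {zero}  {zero}  ()
    ordered {zero}  {suc k} _          = head-before (Tail.left k)
    ordered {suc i} {zero}  ()
    ordered {suc i} {suc k} (s≤s i<k) =
      subst (_< o + Tail.left k) (sym (shifted i)) (+-monoʳ-< o (Tail.ordered i<k))

module _ {n M} {H : Graph n} (P : Path H M) where

  -- Positions beyond M are clamped to the last vertex.
  vertex-at : ℕ → Fin n
  vertex-at j = vert P (fromℕ< (s≤s (m⊓n≤n j M)))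

  private
    toℕ-clamp : ∀ {j} → j ≤ M → toℕ (fromℕ< (s≤s (m⊓n≤n j M))) ≡ j
    toℕ-clamp j≤M = trans (toℕ-fromℕ< _) (m≤n⇒m⊓n≡m j≤M)

    +-toℕ-≤ : ∀ s {m} (i : Fin (suc m)) → s + toℕ i ≤ s + m
    +-toℕ-≤ s i = +-monoʳ-≤ s (≤-pred (toℕ<n i))

  vertex-at-toℕ : ∀ i → vertex-at (toℕ i) ≡ vert P i
  vertex-at-toℕ i = cong (vert P) (toℕ-injective (toℕ-clamp (≤-pred (toℕ<n i))))

  vertex-at-injective : ∀ {i j} → i ≤ M → j ≤ M → vertex-at i ≡ vertex-at j → i ≡ j
  vertex-at-injective i≤M j≤M e =
    trans (sym (toℕ-clamp i≤M)) (trans (cong toℕ (inj P e)) (toℕ-clamp j≤M))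

  vertex-at-adjacent : ∀ {j} → j < M → Adj H (vertex-at j) (vertex-at (suc j))
  vertex-at-adjacent j<M =
    subst₂ (λ a b → Adj H (vertex-at a) (vertex-at b))
      (trans (toℕ-inject₁ k) (toℕ-fromℕ< j<M)) (cong suc (toℕ-fromℕ< j<M))
      (subst₂ (Adj H) (sym (vertex-at-toℕ (inject₁ k))) (sym (vertex-at-toℕ (suc k))) (adj P k))
    where
    k = fromℕ< j<M

  no-consecutive-outside : ∀ inU → EdgesMeetU H inU → NoConsecutiveFalse (suc M) (inU ∘ vertex-at)
  no-consecutive-outside inU meet i (s≤s i<M) out
    with meet (vertex-at i) (vertex-at (suc i)) (vertex-at-adjacent i<M)
  ... | inj₁ inside = contradiction (trans (sym inside) out) λ ()
  ... | inj₂ inside = inside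

  segment : ∀ s m → s + m ≤ M → Path H m
  segment s m s+m≤M = record
    { vert = λ i → vertex-at (s + toℕ i)
    ; inj  = λ {i} {i′} e → toℕ-injective (+-cancelˡ-≡ s _ _
               (vertex-at-injective (≤-trans (+-toℕ-≤ s i) s+m≤M) (≤-trans (+-toℕ-≤ s i′) s+m≤M) e))
    ; adj  = λ i → subst₂ (λ a b → Adj H (vertex-at a) (vertex-at b))
               (cong (s +_) (sym (toℕ-inject₁ i))) (sym (+-suc s (toℕ i)))
               (vertex-at-adjacent (<-≤-trans (+-monoʳ-< s (toℕ<n i)) s+m≤M))
    }

  segment-start : ∀ s m (p : s + m ≤ M) → start (segment s m p) ≡ vertex-at s
  segment-start s _ _ = cong vertex-at (+-identityʳ s)

  segment-end : ∀ s m (p : s + m ≤ M) → end (segment s m p) ≡ vertex-at (s + m)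
  segment-end s m _ = cong (λ x → vertex-at (s + x)) (toℕ-fromℕ m)

  segment-disjoint : ∀ {s m s′ m′} (p : s + m ≤ M) (p′ : s′ + m′ ≤ M) → s + m < s′ →
    Disjoint (segment s m p) (segment s′ m′ p′)
  segment-disjoint {s} {m} {s′} p p′ before i i′ e =
    <-irrefl (vertex-at-injective (≤-trans (+-toℕ-≤ s i) p) (≤-trans (+-toℕ-≤ s′ i′) p′) e)
      (≤-<-trans (+-toℕ-≤ s i) (<-≤-trans before (m≤m+n s′ (toℕ i′))))

lemma3p4 : (t : ℕ) → 1 ≤ t → (k : Fin t → ℕ) → (∀ i → 2 ≤ k i) →
    {n : ℕ} (H : Graph n) (inU : Fin n → Bool) → EdgesMeetU H inU →
    Path H (4 * Σ[ (λ i → k i ∸ 1) ] + t ∸ 1) →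
    Σ ((i : Fin t) → Path H (2 * (k i ∸ 1))) λ P →
      (∀ i j → ¬ (i ≡ j) → Disjoint (P i) (P j)) ×
      (∀ i → (inU (start (P i)) ≡ true) × (inU (end (P i)) ≡ true))
lemma3p4 t t≥1 k k≥2 H inU meet P = segments , disjoint , ends-in-U
  where
  c : Fin t → ℕ
  c i = k i ∸ 1
  length≡ : suc (4 * Σ[ c ] + t ∸ 1) ≡ 4 * Σ[ c ] + t
  length≡ = suc-pred _ {{>-nonZero (≤-trans t≥1 (m≤n+m t _))}}
  outside-isolated : NoConsecutiveFalse (4 * Σ[ c ] + t) (inU ∘ vertex-at P)
  outside-isolated =
    subst (λ ℓ → NoConsecutiveFalse ℓ (inU ∘ vertex-at P)) length≡ (no-consecutive-outside P inU meet)
  open TrueEndedWindows (true-ended-windows c (λ i → ∸-monoˡ-≤ 1 (k≥2 i)) outside-isolated)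
  inside : ∀ i → left i + 2 * c i ≤ 4 * Σ[ c ] + t ∸ 1
  inside i = ≤-pred (subst (left i + 2 * c i <_) (sym length≡) (fits i))
  segments : (i : Fin t) → Path H (2 * c i)
  segments i = segment P (left i) (2 * c i) (inside i)
  disjoint : ∀ i j → ¬ (i ≡ j) → Disjoint (segments i) (segments j)
  disjoint i j i≢j with Finₚ.<-cmp i j
  ... | tri< i<j _ _ = segment-disjoint P (inside i) (inside j) (ordered i<j)
  ... | tri≈ _ i≡j _ = contradiction i≡j i≢j
  ... | tri> _ _ j<i = λ x y e → segment-disjoint P (inside j) (inside i) (ordered j<i) y x (sym e)
  ends-in-U : ∀ i → (inU (start (segments i)) ≡ true) × (inU (end (segments i)) ≡ true)
  ends-in-U i =
    subst (λ v → inU v ≡ true) (sym (segment-start P (left i) (2 * c i) (inside i))) (left-true i) ,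
    subst (λ v → inU v ≡ true) (sym (segment-end P (left i) (2 * c i) (inside i))) (right-true i)
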